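{- Let $P = (p_n)_{n<\omega}, Q = (q_m)_{m<\omega} \in \mathbf{FIN}_k^{[\infty]}$, and suppose $N$ is the least number such that $\langle p_0,\dots,p_{N-1} \rangle \cap \langle Q \rangle \neq \emptyset$. Then there exists an intertwined block $p \in \langle p_0,\dots,p_{N-1} \rangle \cap \langle Q \rangle$.
   Context: Fix an integer $k \geq 1$. $\mathbf{FIN}_k$ is the set of all maps $p : \omega \to \{0,\dots,k\}$ whose support $\mathrm{supp}(p) = \{n : p(n) \neq 0\}$ is finite and such that $k \in \mathrm{ran}(p)$ (elements of $\mathbf{FIN}_k$ are called blocks). For maps $p,q$ with disjoint supports, $p+q$ is the map equal to $p$ on $\mathrm{supp}(p)$, to $q$ on $\mathrm{supp}(q)$, and $0$ elsewhere. The tetris operation is $T(p)(n) = \max\{p(n)-1,0\}$. Write $p < q$ if $\max\mathrm{supp}(p) < \min\mathrm{supp}(q)$. $\mathbf{FIN}_k^{[\infty]}$ is the set of infinite block sequences $P = (p_n)_{n<\omega}$ in $\mathbf{FIN}_k$ with $p_n < p_{n+1}$ for all $n$. For a finite block sequence $p_0 < \cdots < p_{N-1}$, $\langle p_0,\dots,p_{N-1} \rangle$ is the set of all $T^{j_0}(p_{n_0}) + \cdots + T^{j_m}(p_{n_m})$ with $n_0 < \cdots < n_m < N$, $j_0,\dots,j_m < k$ and $\min_i j_i = 0$; for infinite $P$, $\langle P \rangle = \bigcup_N \langle p_0,\dots,p_{N-1} \rangle$. Intertwined blocks: given $P = (p_n), Q = (q_m)$ and $p \in \langle P \rangle \cap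 \langle Q \rangle$, write $p = T^{i_0'}(p_{i_0}) + \cdots + T^{i_{n-1}'}(p_{i_{n-1}}) = T^{j_0'}(q_{j_0}) + \cdots + T^{j_{m-1}'}(q_{j_{m-1}})$ with $i_0 < \cdots < i_{n-1}$, $j_0 < \cdots < j_{m-1}$ and all exponents $< k$. Let $G_p$ be the bipartite graph with vertex set the disjoint union of $V_1 = \{i_0,\dots,i_{n-1}\}$ and $V_2 = \{j_0,\dots,j_{m-1}\}$, where $i_g \in V_1$ and $j_h \in V_2$ are adjacent iff $\mathrm{supp}(T^{i_g'}(p_{i_g})) \cap \mathrm{supp}(T^{j_h'}(q_{j_h})) \neq \emptyset$. The block $p$ is intertwined if $G_p$ is connected. -}

module Defs where

open import Data.Nat using (ℕ; zero; suc; _+_; _∸_; _≤_; _<_)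
open import Data.Product using (Σ; ∃; _×_; _,_; proj₁; proj₂)
open import Data.Sum using (_⊎_; inj₁; inj₂)
open import Data.List using (List; []; _∷_; map; length; lookup)
open import Data.List.Relation.Unary.All using (All)
open import Data.List.Relation.Unary.Any using (Any)
open import Data.List.Relation.Unary.Linked using (Linked)
open import Data.Fin using (Fin)
open import Data.Empty using (⊥)
open import Relation.Nullary using (¬_)
open import Relation.Binary.PropositionalEquality using (_≡_; _≢_)
open import Relation.Binary.Construct.Closure.ReflexiveTransitive using (Star)
import Data.Nat.Properties as ℕP

-- A "map" ω → {0,…,k} is represented as a function ℕ → ℕ (values bounded by k
-- in the notion of block below).
Map : Set
Map = ℕ → ℕ

InSupp : Map → ℕ → Set
InSupp p n = p n ≢ 0

IsBlock : ℕ → Map → Set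
IsBlock k p =
  (∀ n → p n ≤ k) ×
  (∃ λ B → ∀ n → B ≤ n → p n ≡ 0) ×
  (∃ λ n → p n ≡ k)

_≺_ : Map → Map → Set
p ≺ q = ∀ a b → InSupp p a → InSupp q b → a < b

IsBlockSeq : ℕ → (ℕ → Map) → Set
IsBlockSeq k P = (∀ n → IsBlock k (P n)) × (∀ n → P n ≺ P (suc n))

T : Map → Map
T p n = p n ∸ 1

T^ : ℕ → Map → Map
T^ zero    p = p
T^ (suc j) p = T (T^ j p)

-- addition of maps (pointwise; agrees with the paper's p+q on disjoint supports)
_⊕_ : Map → Map → Map
(p ⊕ q) n = p n + q n

zeroMap : Map
zeroMap n = 0

-- A formal combination: list of (index, exponent) pairs, representing
-- T^{j_0}(p_{n_0}) + ⋯ + T^{j_m}(p_{n_m}).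
Comb : Set
Comb = List (ℕ × ℕ)

term : (ℕ → Map) → ℕ × ℕ → Map
term P (i , j) = T^ j (P i)

eval : (ℕ → Map) → Comb → Map
eval P []       = zeroMap
eval P (t ∷ c)  = term P t ⊕ eval P c

-- validity of a combination drawn from p_0,…,p_{N-1}:
-- indices strictly increasing and < N, exponents < k, some exponent = 0
-- (the latter also forces the combination to be nonempty).
ValidComb : ℕ → ℕ → Comb → Set
ValidComb k N c =
  Linked _<_ (map proj₁ c) ×
  All (λ t → proj₁ t < N) c ×
  All (λ t → proj₂ t < k) c ×
  Any (λ t → proj₂ t ≡ 0) c

Represents : ℕ → (ℕ → Map) → ℕ → Comb → Map → Set
Represents k P N c p = ValidComb k N c × (∀ n → p n ≡ eval P c n)

InSpanFin : ℕ → (ℕ → Map) → ℕ → Map → Set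
InSpanFin k P N p = ∃ λ c → Represents k P N c p

InSpan : ℕ → (ℕ → Map) → Map → Set
InSpan k P p = ∃ λ N → InSpanFin k P N p

-- The bipartite graph G_p for representations c (w.r.t. P) and d (w.r.t. Q).
-- Vertices: positions in c (V₁) ⊎ positions in d (V₂).
Vertex : Comb → Comb → Set
Vertex c d = Fin (length c) ⊎ Fin (length d)

Overlap : Map → Map → Set
Overlap f g = ∃ λ n → InSupp f n × InSupp g n

Adj : (ℕ → Map) → (ℕ → Map) → (c d : Comb) → Vertex c d → Vertex c d → Set
Adj P Q c d (inj₁ a) (inj₂ b) = Overlap (term P (lookup c a)) (term Q (lookup d b))
Adj P Q c d (inj₂ b) (inj₁ a) = Overlap (term P (lookup c a)) (term Q (lookup d b))
Adj P Q c d (inj₁ _) (inj₁ _) = ⊥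
Adj P Q c d (inj₂ _) (inj₂ _) = ⊥

Connected : (ℕ → Map) → (ℕ → Map) → (c d : Comb) → Set
Connected P Q c d = ∀ u v → Star (Adj P Q c d) u v

-- p is intertwined (w.r.t. P and Q): p ∈ ⟨P⟩ ∩ ⟨Q⟩ and the graph G_p built from
-- its representations over P and over Q is connected.  (Representations over a
-- block sequence are unique, so "some representations" = "the representations".)
Intertwined : ℕ → (ℕ → Map) → (ℕ → Map) → Map → Set
Intertwined k P Q p =
  ∃ λ N → ∃ λ M → ∃ λ c → ∃ λ d →
    Represents k P N c p × Represents k Q M d p × Connected P Q c d

-- Represent the common block p over P by a combination c and over Q by a combination d, and sweep
-- the positions from left to right. The vertices of G_p whose supports meet [0, x) stay connected,
-- except at a position x where p is nonzero on both sides of x and no term of c or d straddles x.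
-- There p splits into its parts below and above x. Each part is again a common block, over fewer
-- terms of P, and one of them keeps a term of exponent 0, so we recurse into that one. Once G_p is
-- connected, the Q-side also has a term of exponent 0, because p attains the value k.
module Submission where

open import Defs
open import Data.Nat
  using (ℕ; zero; suc; _+_; _∸_; _≤_; _<_; z≤n; z<s; s≤s; s≤s⁻¹; _≟_; _<?_; pred)
open import Data.Nat.Properties
open import Data.Nat.Induction using (<-wellFounded)
open import Data.Product using (∃; ∃₂; _×_; _,_; proj₁; proj₂)
open import Data.Sum using (_⊎_; inj₁; inj₂; [_,_]; map₂)
open import Data.List using ([]; _∷_; map; length; lookup; filter)
open import Data.List.Properties using (filter-notAll)
open import Data.List.Membership.Propositional using (find; lose)
open import Data.List.Membership.Propositional.Properties using (∈-lookup; ∈-filter⁺)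
open import Data.List.Relation.Unary.All as All using (All; []; _∷_)
import Data.List.Relation.Unary.All.Properties as All
open import Data.List.Relation.Unary.Any as Any using (Any; here; there)
open import Data.List.Relation.Unary.Any.Properties using (lookup-index)
open import Data.List.Relation.Unary.AllPairs as AllPairs using (AllPairs; _∷_)
import Data.List.Relation.Unary.AllPairs.Properties as AllPairs
open import Data.List.Relation.Unary.Linked using (Linked)
import Data.List.Relation.Unary.Linked.Properties as Linked
open import Data.Fin as Fin using (zero; suc)
import Data.Fin.Properties as Fin
open import Data.Empty using (⊥; ⊥-elim)
open import Function using (_∘_; _on_)
open import Induction.WellFounded using (WellFounded; Acc; acc)
import Relation.Binary.Construct.On as On
open import Relation.Binary.Construct.Closure.ReflexiveTransitive as Star
  using (Star; ε; _◅_; _◅◅_)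
open import Relation.Binary.Definitions using (Symmetric; Tri; tri<; tri≈; tri>)
open import Relation.Binary.PropositionalEquality hiding ([_])
open import Relation.Nullary using (¬_; Dec; yes; no; ¬?)
open import Relation.Nullary.Decidable using (decidable-stable)
open import Relation.Unary using (Decidable)
open import Relation.Unary.Properties using (∁?)

T^-apply : ∀ j (f : Map) n → T^ j f n ≡ f n ∸ j
T^-apply zero    f n = refl
T^-apply (suc j) f n = begin
  T^ j f n ∸ 1   ≡⟨ cong (_∸ 1) (T^-apply j f n) ⟩
  f n ∸ j ∸ 1    ≡⟨ ∸-+-assoc (f n) j 1 ⟩
  f n ∸ (j + 1)  ≡⟨ cong (f n ∸_) (+-comm j 1) ⟩
  f n ∸ suc j    ∎
  where open ≡-Reasoning

T^-zero : ∀ j {f : Map} {n} → f n ≡ 0 → T^ j f n ≡ 0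
T^-zero j {f} {n} fn≡0 = trans (T^-apply j f n) (trans (cong (_∸ j) fn≡0) (0∸n≡0 j))

InSupp-T^ : ∀ j {f : Map} {n} → InSupp (T^ j f) n → InSupp f n
InSupp-T^ j n∈ fn≡0 = n∈ (T^-zero j fn≡0)

¬¬≡0⇒≡0 : ∀ {m} → ¬ ¬ m ≡ 0 → m ≡ 0
¬¬≡0⇒≡0 {m} = decidable-stable (m ≟ 0)

≺-via : ∀ {f g h : Map} {m} → InSupp g m → f ≺ g → g ≺ h → f ≺ h
≺-via m∈ f≺g g≺h a b a∈ b∈ = <-trans (f≺g a _ a∈ m∈) (g≺h _ b m∈ b∈)

Below : Map → ℕ → Set
Below f x = ∃ λ n → n < x × InSupp f n

below? : ∀ f x → Dec (Below f x)
below? f = anyUpTo? (λ n → ¬? (f n ≟ 0))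

¬Below⇒≡0 : ∀ {f x n} → ¬ Below f x → n < x → f n ≡ 0
¬Below⇒≡0 ¬below n<x = ¬¬≡0⇒≡0 λ n∈ → ¬below (_ , n<x , n∈)

Below-suc : ∀ {f x} → Below f (suc x) → Below f x ⊎ InSupp f x
Below-suc (n , n<1+x , n∈) with m≤n⇒m<n∨m≡n (s≤s⁻¹ n<1+x)
... | inj₁ n<x  = inj₁ (n , n<x , n∈)
... | inj₂ refl = inj₂ n∈

OneSided : ℕ → Map → Set
OneSided y f = Below f y → ∀ n → y ≤ n → f n ≡ 0

module _ {A : Set} where

  All-lookup : ∀ {P : A → Set} {xs} → All P xs → ∀ i → P (lookup xs i)
  All-lookup pxs i = All.lookup pxs (∈-lookup i)

  All-tabulate : ∀ {P : A → Set} {xs} → (∀ i → P (lookup xs i)) → All P xs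
  All-tabulate {P} h =
    All.tabulate λ x∈xs → subst P (sym (lookup-index x∈xs)) (h (Any.index x∈xs))

  Any-lookup : ∀ {P : A → Set} {xs} i → P (lookup xs i) → Any P xs
  Any-lookup i = lose (∈-lookup i)

  AllPairs-lookup : ∀ {R : A → A → Set} {xs} → AllPairs R xs →
                    ∀ {i j} → i Fin.< j → R (lookup xs i) (lookup xs j)
  AllPairs-lookup (r ∷ _)  {zero}  {suc j} _         = All-lookup r j
  AllPairs-lookup (_ ∷ rs) {suc i} {suc j} (s≤s i<j) = AllPairs-lookup rs i<j

  Any-filter-split : ∀ {P S : A → Set} (S? : Decidable S) {xs} → Any P xs →
                     Any P (filter S? xs) ⊎ Any P (filter (∁? S?) xs)
  Any-filter-split S? p with find p
  ... | x , x∈xs , px with S? x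
  ...   | yes s  = inj₁ (lose (∈-filter⁺ S? x∈xs s) px)
  ...   | no  ¬s = inj₂ (lose (∈-filter⁺ (∁? S?) x∈xs ¬s) px)

module Evaluation (R : ℕ → Map) where

  term≤eval : ∀ c i n → term R (lookup c i) n ≤ eval R c n
  term≤eval (t ∷ c) zero    n = m≤m+n _ _
  term≤eval (t ∷ c) (suc i) n = ≤-trans (term≤eval c i n) (m≤n+m _ _)

  InSupp-eval : ∀ c {n} → InSupp (eval R c) n → ∃ λ i → InSupp (term R (lookup c i)) n
  InSupp-eval []      n∈ = ⊥-elim (n∈ refl)
  InSupp-eval (t ∷ c) {n} n∈ with term R t n ≟ 0
  ... | no  n∈t = zero , n∈t
  ... | yes t≡0 with InSupp-eval c (λ c≡0 → n∈ (cong₂ _+_ t≡0 c≡0))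
  ...   | i , n∈i = suc i , n∈i

  eval-zero : ∀ c {n} → All (λ t → term R t n ≡ 0) c → eval R c n ≡ 0
  eval-zero []      []          = refl
  eval-zero (t ∷ c) (t≡0 ∷ c≡0) = cong₂ _+_ t≡0 (eval-zero c c≡0)

  eval-filter : ∀ {S : ℕ × ℕ → Set} (S? : Decidable S) c {n} →
                All (λ t → ¬ S t → term R t n ≡ 0) c → eval R (filter S? c) n ≡ eval R c n
  eval-filter S? []      []       = refl
  eval-filter S? (t ∷ c) {n} (h ∷ hs) with S? t
  ... | yes _ = cong (term R t n +_) (eval-filter S? c hs)
  ... | no ¬s = trans (eval-filter S? c hs) (cong (_+ eval R c n) (sym (h ¬s)))

  eval-filter-zero : ∀ {S : ℕ × ℕ → Set} (S? : Decidable S) c {n} →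
                     All (λ t → S t → term R t n ≡ 0) c → eval R (filter S? c) n ≡ 0
  eval-filter-zero S? c h = eval-zero (filter S? c)
    (All.zipWith (λ (s⇒0 , s) → s⇒0 s) (All.filter⁺ S? h , All.all-filter S? c))

  Ordered : Comb → Set
  Ordered = AllPairs (λ s t → term R s ≺ term R t)

  eval-ordered : ∀ {c n} → Ordered c → InSupp (eval R c) n →
                 ∃ λ i → eval R c n ≡ term R (lookup c i) n
  eval-ordered {[]}    _ n∈ = ⊥-elim (n∈ refl)
  eval-ordered {t ∷ c} {n} (t≺c ∷ c-ord) n∈ with term R t n ≟ 0
  ... | no n∈t = zero , trans (cong (term R t n +_) c≡0) (+-identityʳ _)
    where
    c≡0 : eval R c n ≡ 0
    c≡0 = eval-zero c
      (All.map (λ t≺s → ¬¬≡0⇒≡0 λ n∈s → <-irrefl refl (t≺s n n n∈t n∈s)) t≺c)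
  ... | yes t≡0 with eval-ordered c-ord (λ c≡0 → n∈ (cong₂ _+_ t≡0 c≡0))
  ...   | i , c≡i = suc i , trans (cong (_+ eval R c n) t≡0) c≡i

  -- The supports of distinct terms are separated, so no term straddles the left end of another.
  ordered-OneSided : ∀ {c x} → Ordered c → ∀ i → InSupp (term R (lookup c i)) x →
                     ¬ Below (term R (lookup c i)) x → All (OneSided x ∘ term R) c
  ordered-OneSided {c} {x} c-ord i x∈i i-starts = All-tabulate λ j (m , m<x , m∈j) n x≤n →
    ¬¬≡0⇒≡0 λ n∈j → separated j m<x m∈j x≤n n∈j (Fin.<-cmp j i)
    where
    separated : ∀ j {m n} → m < x → InSupp (term R (lookup c j)) m →
                x ≤ n → InSupp (term R (lookup c j)) n →
                Tri (j Fin.< i) (j ≡ i) (i Fin.< j) → ⊥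
    separated j m<x m∈j x≤n n∈j (tri< j<i _ _) =
      <⇒≱ (AllPairs-lookup c-ord j<i _ x n∈j x∈i) x≤n
    separated j m<x m∈j x≤n n∈j (tri≈ _ refl _) = i-starts (_ , m<x , m∈j)
    separated j m<x m∈j x≤n n∈j (tri> _ _ i<j) =
      <-asym (AllPairs-lookup c-ord i<j x _ x∈i m∈j) m<x

  module _ (y : ℕ) where

    starts-below? : Decidable (λ t → Below (term R t) y)
    starts-below? t = below? (term R t) y

    lower upper : Comb → Comb
    lower = filter starts-below?
    upper = filter (∁? starts-below?)

    eval-lower-< : ∀ c {n} → n < y → eval R (lower c) n ≡ eval R c n
    eval-lower-< c n<y =
      eval-filter starts-below? c (All.universal (λ _ ¬below → ¬Below⇒≡0 ¬below n<y) c)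

    eval-lower-≥ : ∀ {c n} → All (OneSided y ∘ term R) c → y ≤ n → eval R (lower c) n ≡ 0
    eval-lower-≥ {c} c-sided y≤n =
      eval-filter-zero starts-below? c (All.map (λ sided below → sided below _ y≤n) c-sided)

    eval-upper-< : ∀ c {n} → n < y → eval R (upper c) n ≡ 0
    eval-upper-< c n<y =
      eval-filter-zero (∁? starts-below?) c (All.universal (λ _ ¬below → ¬Below⇒≡0 ¬below n<y) c)

    eval-upper-≥ : ∀ {c n} → All (OneSided y ∘ term R) c → y ≤ n →
                   eval R (upper c) n ≡ eval R c n
    eval-upper-≥ {c} c-sided y≤n = eval-filter (∁? starts-below?) c
      (All.map (λ {t} sided ¬¬below → sided (decidable-stable (starts-below? t) ¬¬below) _ y≤n)
               c-sided)

    lower-shorter : ∀ {c n} → All (OneSided y ∘ term R) c → InSupp (eval R c) n → y ≤ n →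
                    length (lower c) < length c
    lower-shorter {c} c-sided n∈ y≤n with InSupp-eval c n∈
    ... | i , n∈i = filter-notAll starts-below? c
                      (Any-lookup i λ below → n∈i (All-lookup c-sided i below _ y≤n))

    upper-shorter : ∀ {c n} → InSupp (eval R c) n → n < y → length (upper c) < length c
    upper-shorter {c} n∈ n<y with InSupp-eval c n∈
    ... | i , n∈i = filter-notAll (∁? starts-below?) c
                      (Any-lookup i λ ¬below → ¬below (_ , n<y , n∈i))

open Evaluation using (Ordered; lower; upper)

module _ {P Q : ℕ → Map} {c d : Comb} {y : ℕ}
         (c-sided : All (OneSided y ∘ term P) c) (d-sided : All (OneSided y ∘ term Q) d)
         (c≗d : eval P c ≗ eval Q d) where

  private
    module EP = Evaluation P
    module EQ = Evaluation Q

  lower-≗ : eval P (lower P y c) ≗ eval Q (lower Q y d)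
  lower-≗ n with n <? y
  ... | yes n<y = begin
    eval P (lower P y c) n ≡⟨ EP.eval-lower-< y c n<y ⟩
    eval P c n             ≡⟨ c≗d n ⟩
    eval Q d n             ≡⟨ EQ.eval-lower-< y d n<y ⟨
    eval Q (lower Q y d) n ∎
    where open ≡-Reasoning
  ... | no n≮y =
    trans (EP.eval-lower-≥ y c-sided (≮⇒≥ n≮y)) (sym (EQ.eval-lower-≥ y d-sided (≮⇒≥ n≮y)))

  upper-≗ : eval P (upper P y c) ≗ eval Q (upper Q y d)
  upper-≗ n with n <? y
  ... | yes n<y = trans (EP.eval-upper-< y c n<y) (sym (EQ.eval-upper-< y d n<y))
  ... | no n≮y = begin
    eval P (upper P y c) n ≡⟨ EP.eval-upper-≥ y c-sided (≮⇒≥ n≮y) ⟩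
    eval P c n             ≡⟨ c≗d n ⟩
    eval Q d n             ≡⟨ EQ.eval-upper-≥ y d-sided (≮⇒≥ n≮y) ⟨
    eval Q (upper Q y d) n ∎
    where open ≡-Reasoning

Untetrised : ℕ × ℕ → Set
Untetrised t = proj₂ t ≡ 0

untetrised? : Decidable Untetrised
untetrised? t = proj₂ t ≟ 0

module BlockSequence {k : ℕ} (k≥1 : 1 ≤ k) {R : ℕ → Map} (R-blocks : IsBlockSeq k R) where

  open Evaluation R using (eval-ordered)

  private
    block : ∀ i → IsBlock k (R i)
    block = proj₁ R-blocks

  term-nonempty : ∀ i {j} → j < k → ∃ (InSupp (term R (i , j)))
  term-nonempty i {j} j<k with proj₂ (proj₂ (block i))
  ... | n , Rᵢn≡k = n , λ t≡0 → <⇒≱ j<k (m∸n≡0⇒m≤n (begin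
    k ∸ j        ≡⟨ cong (_∸ j) Rᵢn≡k ⟨
    R i n ∸ j    ≡⟨ T^-apply j (R i) n ⟨
    T^ j (R i) n ≡⟨ t≡0 ⟩
    0            ∎))
    where open ≡-Reasoning

  R-mono : ∀ {i i′} → i < i′ → R i ≺ R i′
  R-mono {i} {suc i′} i<1+i′ with m≤n⇒m<n∨m≡n (s≤s⁻¹ i<1+i′)
  ... | inj₁ i<i′ = ≺-via (proj₂ (term-nonempty i′ k≥1)) (R-mono i<i′) (proj₂ R-blocks i′)
  ... | inj₂ refl = proj₂ R-blocks i

  term-mono : ∀ s t → proj₁ s < proj₁ t → term R s ≺ term R t
  term-mono (i , j) (i′ , j′) i<i′ a b a∈ b∈ =
    R-mono i<i′ a b (InSupp-T^ j a∈) (InSupp-T^ j′ b∈)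

  ordered : ∀ {c} → Linked _<_ (map proj₁ c) → Ordered R c
  ordered lk = AllPairs.map (λ {s} {t} → term-mono s t)
                            (AllPairs.map⁻ (Linked.Linked⇒AllPairs <-trans lk))

  eval-bounded : ∀ c → ∃ λ B → ∀ n → B ≤ n → eval R c n ≡ 0
  eval-bounded []            = 0 , λ _ _ → refl
  eval-bounded ((i , j) ∷ c) with proj₁ (proj₂ (block i)) | eval-bounded c
  ... | B , Rᵢ-bounded | B′ , c-bounded = B + B′ , λ n B+B′≤n →
    cong₂ _+_ (T^-zero j (Rᵢ-bounded n (m+n≤o⇒m≤o B B+B′≤n)))
              (c-bounded n (m+n≤o⇒n≤o B B+B′≤n))

  eval-reaches-k : ∀ {c} → Any Untetrised c → ∃ λ n → k ≤ eval R c n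
  eval-reaches-k {(i , _) ∷ c} (here refl) with proj₂ (proj₂ (block i))
  ... | n , Rᵢn≡k = n , ≤-trans (≤-reflexive (sym Rᵢn≡k)) (m≤m+n _ _)
  eval-reaches-k {t ∷ c} (there c-untet) with eval-reaches-k c-untet
  ... | n , k≤c = n , ≤-trans k≤c (m≤n+m _ _)

  eval-below-k : ∀ {c} → Ordered R c → All (¬_ ∘ Untetrised) c → ∀ n → eval R c n ≤ pred k
  eval-below-k {c} c-ord c-tetrised n with eval R c n ≟ 0
  ... | yes c≡0 = subst (_≤ pred k) (sym c≡0) z≤n
  ... | no  n∈  with eval-ordered c-ord n∈
  ...   | i , c≡i = begin
    eval R c n                                     ≡⟨ c≡i ⟩
    term R (lookup c i) n                          ≡⟨ T^-apply (proj₂ (lookup c i)) _ n ⟩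
    R (proj₁ (lookup c i)) n ∸ proj₂ (lookup c i)
      ≤⟨ ∸-mono (proj₁ (block _) n) (n≢0⇒n>0 (All-lookup c-tetrised i)) ⟩
    k ∸ 1                                          ∎
    where open ≤-Reasoning

vertex-term : (P Q : ℕ → Map) (c d : Comb) → Vertex c d → Map
vertex-term P Q c d (inj₁ i) = term P (lookup c i)
vertex-term P Q c d (inj₂ j) = term Q (lookup d j)

module Walk {P Q : ℕ → Map} {c d : Comb} (c≗d : eval P c ≗ eval Q d)
            (c-ordered : Ordered P c) (d-ordered : Ordered Q d) where

  private
    module EP = Evaluation P
    module EQ = Evaluation Q

    vertex : Vertex c d → Map
    vertex = vertex-term P Q c d

    Edge : Vertex c d → Vertex c d → Set
    Edge = Adj P Q c d

  Adj-sym : Symmetric Edge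
  Adj-sym {inj₁ _} {inj₂ _} o = o
  Adj-sym {inj₂ _} {inj₁ _} o = o

  InSupp-vertex : ∀ u {n} → InSupp (vertex u) n → InSupp (eval P c) n
  InSupp-vertex (inj₁ i) {n} n∈ c≡0 =
    n∈ (n≤0⇒n≡0 (≤-trans (EP.term≤eval c i n) (≤-reflexive c≡0)))
  InSupp-vertex (inj₂ j) {n} n∈ c≡0 =
    n∈ (n≤0⇒n≡0 (≤-trans (EQ.term≤eval d j n) (≤-reflexive (trans (sym (c≗d n)) c≡0))))

  ConnectedBelow : ℕ → Set
  ConnectedBelow x = ∀ u v → Below (vertex u) x → Below (vertex v) x → Star Edge u v

  ConnectedBelow-via : ∀ {x} w → (∀ u → Below (vertex u) x → Star Edge u w) → ConnectedBelow x
  ConnectedBelow-via w reach u v u-below v-below =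
    reach u u-below ◅◅ Star.reverse Adj-sym (reach v v-below)

  extend-joined : ∀ {x} → ConnectedBelow x → ∀ w → Below (vertex w) x →
                  (∀ u → InSupp (vertex u) x → Star Edge u w) → ConnectedBelow (suc x)
  extend-joined conn w w-below reach = ConnectedBelow-via w λ u u-below →
    [ (λ u-below′ → conn u w u-below′ w-below) , reach u ] (Below-suc u-below)

  extend-fresh : ∀ {x} → ¬ Below (eval P c) x → ∀ w →
                 (∀ u → InSupp (vertex u) x → Star Edge u w) → ConnectedBelow (suc x)
  extend-fresh none-below w reach = ConnectedBelow-via w λ u u-below →
    [ (λ (n , n<x , n∈) → ⊥-elim (none-below (n , n<x , InSupp-vertex u n∈))) , reach u ]
    (Below-suc u-below)

  extend-outside : ∀ {x} → eval P c x ≡ 0 → ConnectedBelow x → ConnectedBelow (suc x)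
  extend-outside {x} c≡0 conn u v u-below v-below = conn u v (shrink u u-below) (shrink v v-below)
    where
    shrink : ∀ u → Below (vertex u) (suc x) → Below (vertex u) x
    shrink u u-below =
      [ (λ below → below) , (λ x∈ → ⊥-elim (InSupp-vertex u x∈ c≡0)) ] (Below-suc u-below)

  CutAt : ℕ → Set
  CutAt y = Below (eval P c) y × InSupp (eval P c) y ×
            All (OneSided y ∘ term P) c × All (OneSided y ∘ term Q) d

  step : ∀ {x} → ConnectedBelow x → InSupp (eval P c) x → ConnectedBelow (suc x) ⊎ CutAt x
  step {x} conn x∈ with EP.InSupp-eval c x∈ | EQ.InSupp-eval d (x∈ ∘ trans (c≗d x))
  ... | i , x∈i | j , x∈j = cases
    where
    i~j : Edge (inj₁ i) (inj₂ j)
    i~j = x , x∈i , x∈j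

    j~i : Edge (inj₂ j) (inj₁ i)
    j~i = x , x∈i , x∈j

    reach-i : ∀ u → InSupp (vertex u) x → Star Edge u (inj₁ i)
    reach-i (inj₁ i′) x∈i′ = _◅_ {j = inj₂ j} (x , x∈i′ , x∈j) (j~i ◅ ε)
    reach-i (inj₂ j′) x∈j′ = (x , x∈i , x∈j′) ◅ ε

    reach-j : ∀ u → InSupp (vertex u) x → Star Edge u (inj₂ j)
    reach-j u x∈u = reach-i u x∈u ◅◅ (i~j ◅ ε)

    cases : ConnectedBelow (suc x) ⊎ CutAt x
    cases with below? (vertex (inj₁ i)) x | below? (vertex (inj₂ j)) x | below? (eval P c) x
    ... | yes i-below | _           | _        = inj₁ (extend-joined conn (inj₁ i) i-below reach-i)
    ... | no _        | yes j-below | _        = inj₁ (extend-joined conn (inj₂ j) j-below reach-j)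
    ... | no _        | no _        | no none  = inj₁ (extend-fresh none (inj₁ i) reach-i)
    ... | no i-starts | no j-starts | yes some = inj₂ (some , x∈ ,
      EP.ordered-OneSided c-ordered i x∈i i-starts , EQ.ordered-OneSided d-ordered j x∈j j-starts)

  walk : ∀ x → ConnectedBelow x ⊎ ∃ CutAt
  walk zero    = inj₁ λ { _ _ (_ , () , _) _ }
  walk (suc x) with walk x
  ... | inj₂ cut = inj₂ cut
  ... | inj₁ conn with eval P c x ≟ 0
  ...   | yes c≡0 = inj₁ (extend-outside c≡0 conn)
  ...   | no  x∈  = map₂ (x ,_) (step conn x∈)

  connected-or-cut : (∃ λ B → ∀ n → B ≤ n → eval P c n ≡ 0) →
                     (∀ u → ∃ (InSupp (vertex u))) → Connected P Q c d ⊎ ∃ CutAt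
  connected-or-cut (B , bounded) nonempty with walk B
  ... | inj₂ cut  = inj₂ cut
  ... | inj₁ conn = inj₁ λ u v → conn u v (below-B u) (below-B v)
    where
    below-B : ∀ u → Below (vertex u) B
    below-B u with nonempty u
    ... | n , n∈ = n , ≰⇒> (λ B≤n → InSupp-vertex u n∈ (bounded n B≤n)) , n∈

module Intertwining {k : ℕ} (k≥1 : 1 ≤ k) {P Q : ℕ → Map}
                    (P-blocks : IsBlockSeq k P) (Q-blocks : IsBlockSeq k Q) where

  private
    module BP = BlockSequence k≥1 P-blocks
    module BQ = BlockSequence k≥1 Q-blocks

  Admissible : ℕ → Comb → Set
  Admissible N c =
    Linked _<_ (map proj₁ c) × All (λ t → proj₁ t < N) c × All (λ t → proj₂ t < k) c

  ValidComb⇒Admissible : ∀ {N c} → ValidComb k N c → Admissible N c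
  ValidComb⇒Admissible (lk , indices , exponents , _) = lk , indices , exponents

  Admissible⇒ValidComb : ∀ {N c} → Admissible N c → Any Untetrised c → ValidComb k N c
  Admissible⇒ValidComb (lk , indices , exponents) c-untet = lk , indices , exponents , c-untet

  Admissible-filter : ∀ {N} {S : ℕ × ℕ → Set} (S? : Decidable S) {c} →
                      Admissible N c → Admissible N (filter S? c)
  Admissible-filter S? (lk , indices , exponents) =
    Linked.map⁺ (Linked.filter⁺ S? <-trans (Linked.map⁻ lk)) ,
    All.filter⁺ S? indices , All.filter⁺ S? exponents

  vertex-nonempty : ∀ {N M c d} → Admissible N c → Admissible M d →
                    ∀ (u : Vertex c d) → ∃ (InSupp (vertex-term P Q c d u))
  vertex-nonempty (_ , _ , c-exponents) _ (inj₁ i) = BP.term-nonempty _ (All-lookup c-exponents i)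
  vertex-nonempty _ (_ , _ , d-exponents) (inj₂ j) = BQ.term-nonempty _ (All-lookup d-exponents j)

  IntertwinedPair : ℕ → ℕ → Set
  IntertwinedPair N M = ∃₂ λ c d → Admissible N c × Admissible M d × Any Untetrised c ×
                        eval P c ≗ eval Q d × Connected P Q c d

  _⋖_ : Comb → Comb → Set
  _⋖_ = _<_ on length

  ⋖-wellFounded : WellFounded _⋖_
  ⋖-wellFounded = On.wellFounded length <-wellFounded

  intertwined-part : ∀ {N M} c d → Acc _⋖_ c → Admissible N c → Admissible M d →
                     Any Untetrised c → eval P c ≗ eval Q d → IntertwinedPair N M
  intertwined-part c d (acc smaller) c-adm d-adm c-untet c≗d
    with Walk.connected-or-cut c≗d (BP.ordered (proj₁ c-adm)) (BQ.ordered (proj₁ d-adm))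
                                   (BP.eval-bounded c) (vertex-nonempty c-adm d-adm)
  ... | inj₁ conn = c , d , c-adm , d-adm , c-untet , c≗d , conn
  ... | inj₂ (y , (m , m<y , m∈) , y∈ , c-sided , d-sided)
    with Any-filter-split (Evaluation.starts-below? P y) c-untet
  ...   | inj₁ lower-untet =
    intertwined-part (lower P y c) (lower Q y d)
      (smaller (Evaluation.lower-shorter P y c-sided y∈ ≤-refl))
      (Admissible-filter _ c-adm) (Admissible-filter _ d-adm)
      lower-untet (lower-≗ c-sided d-sided c≗d)
  ...   | inj₂ upper-untet =
    intertwined-part (upper P y c) (upper Q y d)
      (smaller (Evaluation.upper-shorter P y {c} m∈ m<y))
      (Admissible-filter _ c-adm) (Admissible-filter _ d-adm)
      upper-untet (upper-≗ c-sided d-sided c≗d)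

  -- Only an untetrised term lets a block attain the value k.
  Untetrised-transfer : ∀ {c d} → Linked _<_ (map proj₁ d) → Any Untetrised c →
                        eval P c ≗ eval Q d → Any Untetrised d
  Untetrised-transfer {c} {d} d-lk c-untet c≗d with Any.any? untetrised? d
  ... | yes d-untet = d-untet
  ... | no ¬d-untet with BP.eval-reaches-k c-untet
  ...   | n , k≤c = ⊥-elim (<⇒≱ (∸-monoʳ-< z<s k≥1) (begin
    k          ≤⟨ k≤c ⟩
    eval P c n ≡⟨ c≗d n ⟩
    eval Q d n ≤⟨ BQ.eval-below-k (BQ.ordered d-lk) (All.¬Any⇒All¬ d ¬d-untet) n ⟩
    k ∸ 1      ∎))
    where open ≤-Reasoning

  common-block⇒intertwined :
    ∀ {N p} → InSpanFin k P N p → InSpan k Q p →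
    ∃ λ p′ → InSpanFin k P N p′ × InSpan k Q p′ × Intertwined k P Q p′
  common-block⇒intertwined {N} (c , c-valid@(_ , _ , _ , c-untet) , p≗c) (M , d , d-valid , p≗d)
    with intertwined-part c d (⋖-wellFounded c) (ValidComb⇒Admissible c-valid)
                          (ValidComb⇒Admissible d-valid) c-untet (λ n → trans (sym (p≗c n)) (p≗d n))
  ... | c′ , d′ , c′-adm , d′-adm , c′-untet , c′≗d′ , conn =
    eval P c′ , (c′ , c′-rep) , (M , d′ , d′-rep) , (N , M , c′ , d′ , c′-rep , d′-rep , conn)
    where
    c′-rep : Represents k P N c′ (eval P c′)
    c′-rep = Admissible⇒ValidComb c′-adm c′-untet , λ _ → refl
    d′-rep : Represents k Q M d′ (eval P c′)
    d′-rep = Admissible⇒ValidComb d′-adm (Untetrised-transfer (proj₁ d′-adm) c′-untet c′≗d′) , c′≗d′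

lemma3p4 : (k : ℕ) → 1 ≤ k → (P Q : ℕ → Map) →
    IsBlockSeq k P → IsBlockSeq k Q → (N : ℕ) →
    (∃ λ p → InSpanFin k P N p × InSpan k Q p) →
    (∀ M → M < N → ¬ (∃ λ p → InSpanFin k P M p × InSpan k Q p)) →
    ∃ λ p → InSpanFin k P N p × InSpan k Q p × Intertwined k P Q p
lemma3p4 k k≥1 P Q P-blocks Q-blocks N (p , p∈⟨P↾N⟩ , p∈⟨Q⟩) _ =
  Intertwining.common-block⇒intertwined k≥1 P-blocks Q-blocks p∈⟨P↾N⟩ p∈⟨Q⟩
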